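{- Let $k>a\ge1$ and $i,j\ge0$ be integers. Let $\beta^{(k,a;i,j)}$ be the strict partition whose parts are $1,2,\ldots,jk$ together with, for each $m=1,\ldots,i$, the $a$ consecutive integers $jk+(m-1)a+m,\ jk+(m-1)a+m+1,\ \ldots,\ jk+ma+m-1$. Let $\mathcal{T}^r_n$ denote the set of partitions into multiples of $r$ with at most $n$ parts, and let $\mathcal{D}_{k,a;i,j}=\{\lambda\in\mathcal{D}_{k,a}:\mathrm{sl}_{k,a}(\lambda)=i,\ \ell(\lambda)=ai+kj\}$. Then there exists a bijection $$\varphi_{k,a}:\{\beta^{(k,a;i,j)}\}\times\mathcal{T}^a_i\times\mathcal{T}^k_j\to\mathcal{D}_{k,a;i,j},\quad(\beta^{(k,a;i,j)},\mu,\eta)\mapsto\lambda,$$ such that $|\lambda|=|\beta^{(k,a;i,j)}|+|\mu|+|\eta|$, $\ell(\lambda)=\ell(\beta^{(k,a;i,j)})$ and $\mathrm{sl}_{k,a}(\lambda)=\mathrm{sl}_{k,a}(\beta^{(k,a;i,j)})$.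
   Context: For a partition, $|\lambda|$ is the sum of its parts and $\ell(\lambda)$ the number of parts; the empty partition is allowed. A sequence of a strict partition (distinct parts) is a maximal string of consecutive integers all of which are parts. $\mathcal{D}_{k,a}$ is the set of strict partitions all of whose sequences have length congruent to $0$ or $a$ modulo $k$; $\mathrm{sl}_{k,a}(\lambda)$ is the number of sequences of $\lambda$ whose length is congruent to $a$ modulo $k$. -}

module Defs where

open import Data.Bool using (Bool; true; false; _∧_; _∨_; if_then_else_; T)
open import Data.Nat using (ℕ; zero; suc; _+_; _*_; _≡ᵇ_; _<ᵇ_; _≤ᵇ_; _%_)
open import Data.List using (List; []; _∷_; _++_; map; upTo; concatMap; reverse; length)
import Data.List as L
open import Data.Product using (Σ; _×_)
open import Relation.Binary.PropositionalEquality using (_≡_)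

-- Partitions are represented as lists of parts in decreasing order.
-- |λ| = sum λ, ℓ(λ) = length λ.

allB : {A : Set} → (A → Bool) → List A → Bool
allB p [] = true
allB p (x ∷ xs) = p x ∧ allB p xs

-- m mod k (only used with k ≥ 1; convention m mod 0 = m is irrelevant)
_mod_ : ℕ → ℕ → ℕ
m mod zero = m
m mod suc k = m % suc k

weaklyDec : List ℕ → Bool
weaklyDec [] = true
weaklyDec (x ∷ []) = true
weaklyDec (x ∷ y ∷ ys) = (y ≤ᵇ x) ∧ weaklyDec (y ∷ ys)

strictlyDec : List ℕ → Bool
strictlyDec [] = true
strictlyDec (x ∷ []) = true
strictlyDec (x ∷ y ∷ ys) = (y <ᵇ x) ∧ strictlyDec (y ∷ ys)

allPositive : List ℕ → Bool
allPositive = allB (λ x → 0 <ᵇ x)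

isPartition : List ℕ → Bool
isPartition λ′ = allPositive λ′ ∧ weaklyDec λ′

isStrict : List ℕ → Bool
isStrict λ′ = allPositive λ′ ∧ strictlyDec λ′

-- lengths of the sequences (maximal runs of consecutive integers)
-- of a strictly decreasing list
runsFrom : ℕ → ℕ → List ℕ → List ℕ
runsFrom prev n [] = n ∷ []
runsFrom prev n (y ∷ ys) =
  if suc y ≡ᵇ prev then runsFrom y (suc n) ys else n ∷ runsFrom y 1 ys

seqLengths : List ℕ → List ℕ
seqLengths [] = []
seqLengths (x ∷ xs) = runsFrom x 1 xs

inD : ℕ → ℕ → List ℕ → Bool
inD k a λ′ = isStrict λ′ ∧
  allB (λ s → (s mod k ≡ᵇ 0) ∨ (s mod k ≡ᵇ a mod k)) (seqLengths λ′)

sl : ℕ → ℕ → List ℕ → ℕ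
sl k a λ′ = length (L.filter (λ s → s mod k Data.Nat.≟ a mod k) (seqLengths λ′))

inT : ℕ → ℕ → List ℕ → Bool
inT r n μ = isPartition μ ∧ allB (λ x → x mod r ≡ᵇ 0) μ ∧ (length μ ≤ᵇ n)

TSet : ℕ → ℕ → Set
TSet r n = Σ (List ℕ) (λ μ → T (inT r n μ))

DSet : ℕ → ℕ → ℕ → ℕ → Set
DSet k a i j = Σ (List ℕ) (λ λ′ → T (inD k a λ′) × sl k a λ′ ≡ i × length λ′ ≡ a * i + k * j)

beta : ℕ → ℕ → ℕ → ℕ → List ℕ
beta k a i j = reverse
  (map suc (upTo (j * k)) ++
   concatMap (λ m → map (λ t → j * k + m * a + suc m + t) (upTo a)) (upTo i))

BetaSet : ℕ → ℕ → ℕ → ℕ → Set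
BetaSet k a i j = Σ (List ℕ) (λ b → b ≡ beta k a i j)

-- Read from the top, a partition λ ∈ 𝒟_{k,a;i,j} splits uniquely into i blocks of a and j blocks of
-- k consecutive parts: its top sequence has length ≡ a or ≡ 0 (mod k), and one splits off its top a,
-- resp. k, parts.  Conversely, stacking such blocks gives an element of 𝒟_{k,a;i,j} as long as a
-- block touches the part below it only when the sequence it lands on has length ≡ 0 (mod k).  A block
-- above i′ a-blocks and j′ k-blocks starts at y + ai′ + kj′ + 1, where y is its shift; the stacking
-- rule says that shifts weakly increase upwards, strictly just above an a-block.  In β the k-blocks
-- have shift 0 and the a-blocks shifts 0, 1, …, i − 1.  Counting from the bottom starting at 0,
-- giving the m-th a-block shift m + μ_{i−m}/a and the n-th k-block shift η_{j−n}/k (missing parts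
-- being 0), and putting the a-block on top on equal shifts, matches the admissible stacks with the
-- pairs (μ, η).  Raising a block of r parts by one adds r to the sum of parts, whence
-- |λ| = |β| + |μ| + |η|.

module Submission where

open import Defs
open import Data.Nat using (ℕ; _≤_; _<_; _+_)
open import Data.List using (length)
open import Data.Nat.ListAction using (sum)
open import Data.Product using (Σ; _×_; _,_; proj₁)
open import Function.Definitions using (Bijective)
open import Relation.Binary.PropositionalEquality using (_≡_)

open import Data.Bool using (Bool; true; false; T; _∧_; _∨_)
open import Data.Bool.Properties using (T-∧; T-∨; T-≡; T-irrelevant)
open import Data.List using (List; []; _∷_; _++_; [_]; filter; map; upTo; reverse; concatMap)
open import Data.List.Properties
  using (length-++; ++-cancelˡ; ++-assoc; ++-identityʳ; map-++; reverse-++; upTo-∷ʳ; concatMap-++;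
         filter-accept; filter-reject)
open import Data.Nat
  using (NonZero; >-nonZero; zero; suc; _*_; _∸_; _⊔_; _%_; _/_; _≡ᵇ_; _≤ᵇ_; _≤?_; _≟_; z≤n; s≤s; s≤s⁻¹; z<s)
open import Data.Nat.Divisibility using (_∣_; m%n≡0⇒n∣m; n∣m⇒m%n≡0; m∣m*n; ∣⇒≤)
open import Data.Nat.DivMod
  using (m≡m%n+[m/n]*n; m*n%n≡0; n%n≡0; m<n⇒m%n≡m; m%n≤m; %-remove-+ʳ; m*[n/m]≡n; m*n/n≡m; /-monoˡ-≤)
open import Data.Nat.ListAction.Properties using (sum-++)
open import Data.Nat.Properties
open import Data.Nat.Tactic.RingSolver using (solve-∀)
open import Data.Product using (proj₂; ∃; ∃₂)
open import Data.Sum using (_⊎_; inj₁; inj₂; [_,_]′)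
import Data.Sum as Sum
open import Data.Unit using (⊤; tt)
open import Data.Vec using (Vec; []; _∷_)
import Data.Vec as Vec
open import Function.Base using (_∘_)
open import Function.Bundles using (module Equivalence; module Inverse; module Bijection; _↔_; mk↔ₛ′)
import Function.Construct.Composition as Compose
open import Function.Consequences.Propositional using (strictlySurjective⇒surjective)
open import Function.Properties.Inverse using (↔⇒⤖)
open import Relation.Binary.PropositionalEquality
  using (_≢_; refl; sym; trans; cong; cong₂; subst; subst₂; module ≡-Reasoning)
open import Relation.Nullary using (¬_; Irrelevant; yes; no; contradiction)

open Equivalence using (to; from)

Σ-≡-irrelevant : ∀ {A : Set} {P : A → Set} → (∀ {x} → Irrelevant (P x)) →
                 {p q : Σ A P} → proj₁ p ≡ proj₁ q → p ≡ q
Σ-≡-irrelevant irr {x , px} {.x , qx} refl = cong (x ,_) (irr px qx)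

head₀ : List ℕ → ℕ
head₀ []      = 0
head₀ (x ∷ _) = x

mapHead : (ℕ → ℕ) → List ℕ → List ℕ
mapHead f []       = []
mapHead f (x ∷ xs) = f x ∷ xs

allB-++⁺ : ∀ (p : ℕ → Bool) xs {ys} → T (allB p xs) → T (allB p ys) → T (allB p (xs ++ ys))
allB-++⁺ p []       _   pys = pys
allB-++⁺ p (x ∷ xs) pxs pys =
  let px , pxs′ = to T-∧ pxs in from T-∧ (px , allB-++⁺ p xs pxs′ pys)

allB-++⁻ : ∀ (p : ℕ → Bool) xs {ys} → T (allB p (xs ++ ys)) → T (allB p xs) × T (allB p ys)
allB-++⁻ p []       h = tt , h
allB-++⁻ p (x ∷ xs) h =
  let px , h′ = to T-∧ h; pxs , pys = allB-++⁻ p xs h′ in from T-∧ (px , pxs) , pys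

allB-head : ∀ (p : ℕ → Bool) Ls → Ls ≢ [] → T (allB p Ls) → T (p (head₀ Ls))
allB-head p []       Ls≢[] _ = contradiction refl Ls≢[]
allB-head p (L ∷ Ls) _     h = proj₁ (to T-∧ h)

strictlyDec-∷ : ∀ x l → head₀ l < x → T (strictlyDec l) → T (strictlyDec (x ∷ l))
strictlyDec-∷ x []       _   _ = tt
strictlyDec-∷ x (y ∷ ys) y<x h = from T-∧ (<⇒<ᵇ y<x , h)

strictlyDec-∷⁻ : ∀ x l → 0 < x → T (strictlyDec (x ∷ l)) → head₀ l < x × T (strictlyDec l)
strictlyDec-∷⁻ x []       0<x _ = 0<x , tt
strictlyDec-∷⁻ x (y ∷ ys) _   h = let y<ᵇx , h′ = to T-∧ h in <ᵇ⇒< y x y<ᵇx , h′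

weaklyDec-∷ : ∀ x l → head₀ l ≤ x → T (weaklyDec l) → T (weaklyDec (x ∷ l))
weaklyDec-∷ x []       _   _ = tt
weaklyDec-∷ x (y ∷ ys) y≤x h = from T-∧ (≤⇒≤ᵇ y≤x , h)

weaklyDec-∷⁻ : ∀ x l → T (weaklyDec (x ∷ l)) → head₀ l ≤ x × T (weaklyDec l)
weaklyDec-∷⁻ x []       _ = z≤n , tt
weaklyDec-∷⁻ x (y ∷ ys) h = let y≤ᵇx , h′ = to T-∧ h in ≤ᵇ⇒≤ y x y≤ᵇx , h′

[m+n]%d≡m%d⇒n%d≡0 : ∀ m n d .{{_ : NonZero d}} → (m + n) % d ≡ m % d → n % d ≡ 0
[m+n]%d≡m%d⇒n%d≡0 m n d eq = subst (λ x → x % d ≡ 0) [q₁∸q₀]*d≡n (m*n%n≡0 (q₁ ∸ q₀) d)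
  where
  open ≡-Reasoning
  q₀ = m / d
  q₁ = (m + n) / d
  q₁*d≡q₀*d+n : q₁ * d ≡ q₀ * d + n
  q₁*d≡q₀*d+n = +-cancelˡ-≡ (m % d) _ _ (begin
    m % d + q₁ * d        ≡⟨ cong (_+ q₁ * d) eq ⟨
    (m + n) % d + q₁ * d  ≡⟨ m≡m%n+[m/n]*n (m + n) d ⟨
    m + n                 ≡⟨ cong (_+ n) (m≡m%n+[m/n]*n m d) ⟩
    m % d + q₀ * d + n    ≡⟨ +-assoc (m % d) (q₀ * d) n ⟩
    m % d + (q₀ * d + n)  ∎)
  [q₁∸q₀]*d≡n : (q₁ ∸ q₀) * d ≡ n
  [q₁∸q₀]*d≡n = begin
    (q₁ ∸ q₀) * d         ≡⟨ *-distribʳ-∸ d q₁ q₀ ⟩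
    q₁ * d ∸ q₀ * d       ≡⟨ cong (_∸ q₀ * d) q₁*d≡q₀*d+n ⟩
    q₀ * d + n ∸ q₀ * d   ≡⟨ m+n∸m≡n (q₀ * d) n ⟩
    n                     ∎

tri : ℕ → ℕ
tri zero    = 0
tri (suc n) = n + tri n

tri-+ : ∀ m n → tri (m + n) ≡ m * n + tri m + tri n
tri-+ zero    n = refl
tri-+ (suc m) n = trans (cong (m + n +_) (tri-+ m n)) (arith m n (tri m) (tri n))
  where
  arith : ∀ m n tm tn → m + n + (m * n + tm + tn) ≡ suc m * n + (m + tm) + tn
  arith = solve-∀

-- Blocks of consecutive parts and their sequences

block : ℕ → ℕ → List ℕ
block zero    s = []
block (suc r) s = r + s ∷ block r s

length-block-++ : ∀ r s l → length (block r s ++ l) ≡ r + length l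
length-block-++ r s l = trans (length-++ (block r s)) (cong (_+ length l) (length-block r))
  where
  length-block : ∀ r → length (block r s) ≡ r
  length-block zero    = refl
  length-block (suc r) = cong suc (length-block r)

sum-block : ∀ r s → sum (block r s) ≡ r * s + tri r
sum-block zero    s = refl
sum-block (suc r) s = trans (cong (r + s +_) (sum-block r s)) (arith r s (tri r))
  where
  arith : ∀ r s t → r + s + (r * s + t) ≡ suc r * s + (r + t)
  arith = solve-∀

block-+ : ∀ m n s → block (m + n) s ≡ block m (n + s) ++ block n s
block-+ zero    n s = refl
block-+ (suc m) n s = cong₂ _∷_ (+-assoc m n s) (block-+ m n s)

block-++-injective : ∀ r {s s′ l l′} → block (suc r) s ++ l ≡ block (suc r) s′ ++ l′ → s ≡ s′ × l ≡ l′
block-++-injective r {s} {s′} {l} {l′} eq =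
  s≡s′ , ++-cancelˡ (block (suc r) s) l l′ (trans eq (cong (λ c → block (suc r) c ++ l′) (sym s≡s′)))
  where
  s≡s′ = +-cancelˡ-≡ r s s′ (cong head₀ eq)

reverse-map-upTo : ∀ c n → reverse (map (c +_) (upTo n)) ≡ block n c
reverse-map-upTo c zero    = refl
reverse-map-upTo c (suc n) = begin
  reverse (map (c +_) (upTo (suc n)))        ≡⟨ cong (reverse ∘ map (c +_)) (upTo-∷ʳ n) ⟨
  reverse (map (c +_) (upTo n ++ [ n ]))     ≡⟨ cong reverse (map-++ (c +_) (upTo n) [ n ]) ⟩
  reverse (map (c +_) (upTo n) ++ [ c + n ]) ≡⟨ reverse-++ (map (c +_) (upTo n)) [ c + n ] ⟩
  c + n ∷ reverse (map (c +_) (upTo n))      ≡⟨ cong₂ _∷_ (+-comm c n) (reverse-map-upTo c n) ⟩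
  n + c ∷ block n c                          ∎
  where open ≡-Reasoning

concatMap-upTo-suc : ∀ (f : ℕ → List ℕ) n → concatMap f (upTo (suc n)) ≡ concatMap f (upTo n) ++ f n
concatMap-upTo-suc f n = begin
  concatMap f (upTo (suc n))              ≡⟨ cong (concatMap f) (upTo-∷ʳ n) ⟨
  concatMap f (upTo n ++ [ n ])           ≡⟨ concatMap-++ f (upTo n) [ n ] ⟩
  concatMap f (upTo n) ++ (f n ++ [])     ≡⟨ cong (concatMap f (upTo n) ++_) (++-identityʳ (f n)) ⟩
  concatMap f (upTo n) ++ f n             ∎
  where open ≡-Reasoning

isStrict-block++ : ∀ r s l → head₀ l < s → T (isStrict l) → T (isStrict (block r s ++ l))
isStrict-block++ r s l l<s l-strict =
  from T-∧ (allB-++⁺ _ (block r s) (positive r) l-pos , decreasing r)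
  where
  l-pos = proj₁ (to T-∧ l-strict)
  0<s = ≤-<-trans z≤n l<s
  positive : ∀ r → T (allPositive (block r s))
  positive zero    = tt
  positive (suc r) = from T-∧ (<⇒<ᵇ (≤-trans 0<s (m≤n+m s r)) , positive r)
  head< : ∀ r → head₀ (block r s ++ l) < r + s
  head< zero    = l<s
  head< (suc r) = ≤-refl
  decreasing : ∀ r → T (strictlyDec (block r s ++ l))
  decreasing zero    = proj₂ (to T-∧ l-strict)
  decreasing (suc r) = strictlyDec-∷ (r + s) (block r s ++ l) (head< r) (decreasing r)

isStrict-block++⁻ : ∀ r s l → T (isStrict (block (suc r) s ++ l)) → head₀ l < s × T (isStrict l)
isStrict-block++⁻ r s l h =
  let l<s , l-dec = strictlyDec-∷⁻ s l (positive r block-pos) (decreasing r (proj₂ (to T-∧ h)))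
  in l<s , from T-∧ (l-pos , l-dec)
  where
  pos = allB-++⁻ _ (block (suc r) s) (proj₁ (to T-∧ h))
  block-pos = proj₁ pos
  l-pos = proj₂ pos
  positive : ∀ r → T (allPositive (block (suc r) s)) → 0 < s
  positive zero    p = <ᵇ⇒< 0 s (proj₁ (to T-∧ p))
  positive (suc r) p = positive r p
  decreasing : ∀ r → T (strictlyDec (block (suc r) s ++ l)) → T (strictlyDec (s ∷ l))
  decreasing zero    d = d
  decreasing (suc r) d = decreasing r (proj₂ (to T-∧ d))

≡ᵇ-refl : ∀ n → (n ≡ᵇ n) ≡ true
≡ᵇ-refl n = to T-≡ (≡⇒≡ᵇ n n refl)

runsFrom-+ : ∀ p m n ys → runsFrom p (m + n) ys ≡ mapHead (m +_) (runsFrom p n ys)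
runsFrom-+ p m n []       = refl
runsFrom-+ p m n (y ∷ ys) with suc y ≡ᵇ p
... | true  = trans (cong (λ c → runsFrom y c ys) (sym (+-suc m n))) (runsFrom-+ y m (suc n) ys)
... | false = refl

runsFrom-adjacent : ∀ n y ys → runsFrom (suc y) n (y ∷ ys) ≡ runsFrom y (suc n) ys
runsFrom-adjacent n y ys rewrite ≡ᵇ-refl y = refl

runsFrom-gap : ∀ p n y ys → suc y ≢ p → runsFrom p n (y ∷ ys) ≡ n ∷ seqLengths (y ∷ ys)
runsFrom-gap p n y ys y+1≢p with suc y ≡ᵇ p in eq
... | true  = contradiction (≡ᵇ⇒≡ (suc y) p (subst T (sym eq) tt)) y+1≢p
... | false = refl

runsFrom-merge : ∀ p n y ys → suc y ≡ p → runsFrom p n (y ∷ ys) ≡ mapHead (n +_) (seqLengths (y ∷ ys))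
runsFrom-merge .(suc y) n y ys refl = begin
  runsFrom (suc y) n (y ∷ ys)         ≡⟨ runsFrom-adjacent n y ys ⟩
  runsFrom y (suc n) ys               ≡⟨ cong (λ c → runsFrom y c ys) (+-comm 1 n) ⟩
  runsFrom y (n + 1) ys               ≡⟨ runsFrom-+ y n 1 ys ⟩
  mapHead (n +_) (seqLengths (y ∷ ys)) ∎
  where open ≡-Reasoning

runsFrom-block : ∀ r s n ys → runsFrom (r + s) n (block r s ++ ys) ≡ runsFrom s (r + n) ys
runsFrom-block zero    s n ys = refl
runsFrom-block (suc r) s n ys = begin
  runsFrom (suc r + s) n (r + s ∷ block r s ++ ys) ≡⟨ runsFrom-adjacent n (r + s) (block r s ++ ys) ⟩
  runsFrom (r + s) (suc n) (block r s ++ ys)       ≡⟨ runsFrom-block r s (suc n) ys ⟩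
  runsFrom s (r + suc n) ys                         ≡⟨ cong (λ c → runsFrom s c ys) (+-suc r n) ⟩
  runsFrom s (suc r + n) ys                         ∎
  where open ≡-Reasoning

seqLengths-block : ∀ r s ys → seqLengths (block (suc r) s ++ ys) ≡ runsFrom s (suc r) ys
seqLengths-block r s ys =
  trans (runsFrom-block r s 1 ys) (cong (λ c → runsFrom s c ys) (+-comm r 1))

seqLengths≢[] : ∀ x xs → seqLengths (x ∷ xs) ≢ []
seqLengths≢[] x xs = go x 1 xs
  where
  go : ∀ p n ys → runsFrom p n ys ≢ []
  go p n []       ()
  go p n (y ∷ ys) with suc y ≡ᵇ p
  ... | true  = go y (suc n) ys
  ... | false = λ ()

n≤head-runsFrom : ∀ p n ys → n ≤ head₀ (runsFrom p n ys)
n≤head-runsFrom p n []       = ≤-refl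
n≤head-runsFrom p n (y ∷ ys) with suc y ≡ᵇ p
... | true  = ≤-trans (n≤1+n n) (n≤head-runsFrom y (suc n) ys)
... | false = ≤-refl

sum-seqLengths : ∀ l → sum (seqLengths l) ≡ length l
sum-seqLengths []       = refl
sum-seqLengths (x ∷ xs) = go x 1 xs
  where
  go : ∀ p n ys → sum (runsFrom p n ys) ≡ n + length ys
  go p n []       = refl
  go p n (y ∷ ys) with suc y ≡ᵇ p
  ... | true  = trans (go y (suc n) ys) (sym (+-suc n (length ys)))
  ... | false = cong (n +_) (go y 1 ys)

data BlockOnTop (r : ℕ) : List ℕ → Set where
  block-on : ∀ s l → BlockOnTop r (block r s ++ l)

split-block : ∀ r l → r < head₀ (seqLengths l) → BlockOnTop (suc r) l
split-block r (x ∷ xs) r<run = go r x 1 xs (subst (_≤ head₀ (seqLengths (x ∷ xs))) (+-comm 1 r) r<run)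
  where
  go : ∀ r x n xs → r + n ≤ head₀ (runsFrom x n xs) → BlockOnTop (suc r) (x ∷ xs)
  go zero    x n xs       _  = block-on x xs
  go (suc r) x n []       le = contradiction le (<⇒≱ (m<n+m n z<s))
  go (suc r) x n (y ∷ ys) le with suc y ≟ x
  ... | no y+1≢x rewrite runsFrom-gap x n y ys y+1≢x = contradiction le (<⇒≱ (m<n+m n z<s))
  ... | yes refl rewrite runsFrom-adjacent n y ys
    with go r y (suc n) ys (subst (_≤ head₀ (runsFrom y (suc n) ys)) (sym (+-suc r n)) le)
  ...  | block-on s l = block-on s l

-- Decreasing vectors and partitions into multiples of r

vhead₀ : ∀ {n} → Vec ℕ n → ℕ
vhead₀ []      = 0
vhead₀ (x ∷ _) = x

Decreasing : ∀ {n} → Vec ℕ n → Set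
Decreasing []      = ⊤
Decreasing (x ∷ u) = vhead₀ u ≤ x × Decreasing u

Decreasing-irrelevant : ∀ {n} {u : Vec ℕ n} → Irrelevant (Decreasing u)
Decreasing-irrelevant {u = []}    _        _        = refl
Decreasing-irrelevant {u = x ∷ u} (p , dp) (q , dq) = cong₂ _,_ (≤-irrelevant p q) (Decreasing-irrelevant dp dq)

DecVec : ℕ → Set
DecVec n = Σ (Vec ℕ n) Decreasing

zeros : ∀ n → Vec ℕ n
zeros n = Vec.replicate n 0

vhead-zeros : ∀ n → vhead₀ (zeros n) ≡ 0
vhead-zeros zero    = refl
vhead-zeros (suc n) = refl

sum-zeros : ∀ n → Vec.sum (zeros n) ≡ 0
sum-zeros zero    = refl
sum-zeros (suc n) = sum-zeros n

zeros-decreasing : ∀ n → Decreasing (zeros n)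
zeros-decreasing zero    = tt
zeros-decreasing (suc n) = ≤-reflexive (vhead-zeros n) , zeros-decreasing n

module Multiples (r-1 : ℕ) where

  r : ℕ
  r = suc r-1

  inT-∷⁺ : ∀ n x xs → 0 < x → r ∣ x → head₀ xs ≤ x → T (inT r n xs) → T (inT r (suc n) (x ∷ xs))
  inT-∷⁺ n x xs 0<x r∣x xs≤x t =
    let part , rest = to T-∧ t; mults , len = to T-∧ rest; pos , dec = to T-∧ part
    in from T-∧ ( from T-∧ (from T-∧ (<⇒<ᵇ 0<x , pos) , weaklyDec-∷ x xs xs≤x dec)
                , from T-∧ ( from T-∧ (≡⇒≡ᵇ _ 0 (n∣m⇒m%n≡0 x r r∣x) , mults)
                           , ≤⇒≤ᵇ {suc (length xs)} {suc n} (s≤s (≤ᵇ⇒≤ (length xs) n len))))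

  inT-∷⁻ : ∀ n x xs → T (inT r (suc n) (x ∷ xs)) →
           0 < x × r ∣ x × head₀ xs ≤ x × T (inT r n xs)
  inT-∷⁻ n x xs t =
    let part , rest = to T-∧ t; pos , dec = to T-∧ part; 0<ᵇx , pos′ = to T-∧ pos
        mults , len = to T-∧ rest; x%r≡ᵇ0 , mults′ = to T-∧ mults
        xs≤x , dec′ = weaklyDec-∷⁻ x xs dec
    in <ᵇ⇒< 0 x 0<ᵇx , m%n≡0⇒n∣m x r (≡ᵇ⇒≡ _ 0 x%r≡ᵇ0) , xs≤x ,
       from T-∧ ( from T-∧ (pos′ , dec′)
                , from T-∧ (mults′ , ≤⇒≤ᵇ {length xs} {n} (s≤s⁻¹ (≤ᵇ⇒≤ (suc (length xs)) (suc n) len))))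

  inT-zero⁻ : ∀ x xs → ¬ T (inT r 0 (x ∷ xs))
  inT-zero⁻ x xs t = proj₂ (to T-∧ (proj₂ (to (T-∧ {isPartition (x ∷ xs)}) t)))

  quotients : (n : ℕ) → List ℕ → Vec ℕ n
  quotients zero    _        = []
  quotients (suc n) []       = 0 ∷ quotients n []
  quotients (suc n) (x ∷ xs) = x / r ∷ quotients n xs

  -- Stops at the first zero entry: only meaningful on decreasing vectors.
  multiples : ∀ {n} → Vec ℕ n → List ℕ
  multiples []          = []
  multiples (zero ∷ _)  = []
  multiples (suc q ∷ u) = r * suc q ∷ multiples u

  vhead-quotients : ∀ n xs → vhead₀ (quotients n xs) ≤ head₀ xs / r
  vhead-quotients zero    _       = z≤n
  vhead-quotients (suc n) []      = z≤n
  vhead-quotients (suc n) (_ ∷ _) = ≤-refl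

  quotients-decreasing : ∀ n μ → T (inT r n μ) → Decreasing (quotients n μ)
  quotients-decreasing zero    _        _ = tt
  quotients-decreasing (suc n) []       _ = vhead-quotients n [] , quotients-decreasing n [] tt
  quotients-decreasing (suc n) (x ∷ xs) t =
    let _ , _ , xs≤x , t′ = inT-∷⁻ n x xs t
    in ≤-trans (vhead-quotients n xs) (/-monoˡ-≤ r xs≤x) , quotients-decreasing n xs t′

  multiples-quotients : ∀ n μ → T (inT r n μ) → multiples (quotients n μ) ≡ μ
  multiples-quotients zero    []       _ = refl
  multiples-quotients zero    (x ∷ xs) t = contradiction t (inT-zero⁻ x xs)
  multiples-quotients (suc n) []       _ = refl
  multiples-quotients (suc n) (x ∷ xs) t with inT-∷⁻ n x xs t | x / r in x/r≡
  ... | 0<x , r∣x , _ , t′ | zero =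
    contradiction (trans (sym (m*[n/m]≡n r∣x)) (trans (cong (r *_) x/r≡) (*-zeroʳ r))) (>⇒≢ 0<x)
  ... | 0<x , r∣x , _ , t′ | suc q =
    cong₂ _∷_ (trans (cong (r *_) (sym x/r≡)) (m*[n/m]≡n r∣x)) (multiples-quotients n xs t′)

  quotients-zeros : ∀ {n} (u : Vec ℕ n) → Decreasing (0 ∷ u) → quotients n [] ≡ u
  quotients-zeros []          _          = refl
  quotients-zeros (zero ∷ u)  (_ , du)   = cong (0 ∷_) (quotients-zeros u du)

  quotients-multiples : ∀ {n} (u : Vec ℕ n) → Decreasing u → quotients n (multiples u) ≡ u
  quotients-multiples []          _        = refl
  quotients-multiples (zero ∷ u)  du       = cong (0 ∷_) (quotients-zeros u du)
  quotients-multiples (suc q ∷ u) (_ , du) =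
    cong₂ _∷_ (trans (cong (_/ r) (*-comm r (suc q))) (m*n/n≡m (suc q) r)) (quotients-multiples u du)

  head-multiples : ∀ {n} (u : Vec ℕ n) → head₀ (multiples u) ≤ r * vhead₀ u
  head-multiples []          = z≤n
  head-multiples (zero ∷ _)  = z≤n
  head-multiples (suc q ∷ _) = ≤-refl

  multiples-inT : ∀ {n} (u : Vec ℕ n) → Decreasing u → T (inT r n (multiples u))
  multiples-inT []                  _          = tt
  multiples-inT (zero ∷ _)          _          = tt
  multiples-inT {suc n} (suc q ∷ u) (u≤q , du) =
    inT-∷⁺ n (r * suc q) (multiples u) z<s (m∣m*n (suc q))
      (≤-trans (head-multiples u) (*-monoʳ-≤ r u≤q)) (multiples-inT u du)

  sum-quotients : ∀ n μ → T (inT r n μ) → sum μ ≡ r * Vec.sum (quotients n μ)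
  sum-quotients zero    []       _ = sym (*-zeroʳ r)
  sum-quotients zero    (x ∷ xs) t = contradiction t (inT-zero⁻ x xs)
  sum-quotients (suc n) []       _ = sum-quotients n [] tt
  sum-quotients (suc n) (x ∷ xs) t = begin
    x + sum xs                                      ≡⟨ cong₂ _+_ (sym (m*[n/m]≡n r∣x)) (sum-quotients n xs t′) ⟩
    r * (x / r) + r * Vec.sum (quotients n xs)      ≡⟨ *-distribˡ-+ r (x / r) _ ⟨
    r * Vec.sum (quotients (suc n) (x ∷ xs))        ∎
    where
    open ≡-Reasoning
    r∣x = proj₁ (proj₂ (inT-∷⁻ n x xs t))
    t′  = proj₂ (proj₂ (proj₂ (inT-∷⁻ n x xs t)))

  TSet↔DecVec : ∀ n → TSet r n ↔ DecVec n
  TSet↔DecVec n = mk↔ₛ′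
    (λ (μ , t) → quotients n μ , quotients-decreasing n μ t)
    (λ (u , du) → multiples u , multiples-inT u du)
    (λ (u , du) → Σ-≡-irrelevant Decreasing-irrelevant (quotients-multiples u du))
    (λ (μ , t) → Σ-≡-irrelevant T-irrelevant (multiples-quotients n μ t))

module Stacking (k-1 a-1 : ℕ) (a<k : suc a-1 < suc k-1) where

  k a : ℕ
  k = suc k-1
  a = suc a-1

  a%k≢0 : a % k ≢ 0
  a%k≢0 a%k≡0 = 1+n≢0 (trans (sym (m<n⇒m%n≡m a<k)) a%k≡0)

  -- admissible, count and InDSet restate the predicates inside inD, sl and DSet, which therefore
  -- unfold to them definitionally.
  admissible : ℕ → Bool
  admissible s = (s mod k ≡ᵇ 0) ∨ (s mod k ≡ᵇ a mod k)

  admissible-cong : ∀ x y → x % k ≡ y % k → admissible x ≡ admissible y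
  admissible-cong _ _ = cong (λ c → (c ≡ᵇ 0) ∨ (c ≡ᵇ a % k))

  admissible⁻ : ∀ L → T (admissible L) → L % k ≡ 0 ⊎ L % k ≡ a % k
  admissible⁻ L h = Sum.map (≡ᵇ⇒≡ (L % k) 0) (≡ᵇ⇒≡ (L % k) (a % k)) (to T-∨ h)

  count : List ℕ → ℕ
  count Ls = length (filter (λ s → s mod k ≟ a mod k) Ls)

  count-∷-a : ∀ L Ls → L % k ≡ a % k → count (L ∷ Ls) ≡ suc (count Ls)
  count-∷-a L Ls eq = cong length (filter-accept (λ s → s mod k ≟ a mod k) {L} {Ls} eq)

  count-∷-≢ : ∀ L Ls → L % k ≢ a % k → count (L ∷ Ls) ≡ count Ls
  count-∷-≢ L Ls neq = cong length (filter-reject (λ s → s mod k ≟ a mod k) {L} {Ls} neq)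

  count-∷-0 : ∀ L Ls → L % k ≡ 0 → count (L ∷ Ls) ≡ count Ls
  count-∷-0 L Ls eq = count-∷-≢ L Ls (λ eq′ → a%k≢0 (trans (sym eq′) eq))

  count-∷-cong : ∀ x y Ls → x % k ≡ y % k → count (x ∷ Ls) ≡ count (y ∷ Ls)
  count-∷-cong x y Ls eq with y % k ≟ a % k
  ... | yes p = trans (count-∷-a x Ls (trans eq p)) (sym (count-∷-a y Ls p))
  ... | no ¬p = trans (count-∷-≢ x Ls (¬p ∘ trans (sym eq))) (sym (count-∷-≢ y Ls ¬p))

  count-∷ : ∀ x Ls → count (x ∷ Ls) ≡ count [ x ] + count Ls
  count-∷ x Ls with x % k ≟ a % k
  ... | yes p = trans (count-∷-a x Ls p) (cong (_+ count Ls) (sym (count-∷-a x [] p)))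
  ... | no ¬p = trans (count-∷-≢ x Ls ¬p) (cong (_+ count Ls) (sym (count-∷-≢ x [] ¬p)))

  count-a : count [ a ] ≡ 1
  count-a = count-∷-a a [] refl

  count-k : count [ k ] ≡ 0
  count-k = count-∷-0 k [] (n%n≡0 k)

  m%k≡a%k⇒a≤m : ∀ L → L % k ≡ a % k → a ≤ L
  m%k≡a%k⇒a≤m L L%k≡a = subst (_≤ L) (trans L%k≡a (m<n⇒m%n≡m a<k)) (m%n≤m L k)

  a*count≤sum : ∀ Ls → a * count Ls ≤ sum Ls
  a*count≤sum []       = ≤-reflexive (*-zeroʳ a)
  a*count≤sum (L ∷ Ls) with L % k ≟ a % k
  ... | yes p = begin
    a * count (L ∷ Ls)   ≡⟨ cong (a *_) (count-∷-a L Ls p) ⟩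
    a * suc (count Ls)   ≡⟨ *-suc a (count Ls) ⟩
    a + a * count Ls     ≤⟨ +-mono-≤ (m%k≡a%k⇒a≤m L p) (a*count≤sum Ls) ⟩
    L + sum Ls           ∎
    where open ≤-Reasoning
  ... | no ¬p = begin
    a * count (L ∷ Ls)   ≡⟨ cong (a *_) (count-∷-≢ L Ls ¬p) ⟩
    a * count Ls         ≤⟨ a*count≤sum Ls ⟩
    sum Ls               ≤⟨ m≤n+m (sum Ls) L ⟩
    L + sum Ls           ∎
    where open ≤-Reasoning

  topRun : List ℕ → ℕ
  topRun l = head₀ (seqLengths l)

  data CanStack (s : ℕ) : List ℕ → Set where
    on-empty : 0 < s → CanStack s []
    on-run   : ∀ {y ys} → suc y ≡ s → topRun (y ∷ ys) % k ≡ 0 → CanStack s (y ∷ ys)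
    on-gap   : ∀ {y ys} → suc y < s → CanStack s (y ∷ ys)

  data AddBlock (r : ℕ) : List ℕ → List ℕ → Set where
    new-run    : ∀ Ls → AddBlock r Ls (r ∷ Ls)
    extend-run : ∀ L Ls → L % k ≡ 0 → AddBlock r (L ∷ Ls) (r + L ∷ Ls)

  canStack⇒head< : ∀ {s l} → CanStack s l → head₀ l < s
  canStack⇒head< (on-empty 0<s)  = 0<s
  canStack⇒head< (on-run refl _) = ≤-refl
  canStack⇒head< (on-gap y+1<s)  = <-trans (n<1+n _) y+1<s

  extend-top : ∀ r Ls → Ls ≢ [] → head₀ Ls % k ≡ 0 → AddBlock r Ls (mapHead (r +_) Ls)
  extend-top r []       Ls≢[] _     = contradiction refl Ls≢[]
  extend-top r (L ∷ Ls) _     L%k≡0 = extend-run L Ls L%k≡0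

  extend-top⁻ : ∀ r Ls → Ls ≢ [] → head₀ (mapHead (r +_) Ls) % k ≡ r % k → head₀ Ls % k ≡ 0
  extend-top⁻ r []       Ls≢[] _  = contradiction refl Ls≢[]
  extend-top⁻ r (L ∷ Ls) _     eq = [m+n]%d≡m%d⇒n%d≡0 r L k eq

  addBlock : ∀ r s l → CanStack s l → AddBlock (suc r) (seqLengths l) (seqLengths (block (suc r) s ++ l))
  addBlock r s l c rewrite seqLengths-block r s l = go c
    where
    go : ∀ {l} → CanStack s l → AddBlock (suc r) (seqLengths l) (runsFrom s (suc r) l)
    go (on-empty _) = new-run []
    go {y ∷ ys} (on-run y+1≡s top≡0) rewrite runsFrom-merge s (suc r) y ys y+1≡s =
      extend-top (suc r) (seqLengths (y ∷ ys)) (seqLengths≢[] y ys) top≡0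
    go {y ∷ ys} (on-gap y+1<s) rewrite runsFrom-gap s (suc r) y ys (<⇒≢ y+1<s) = new-run _

  unstack : ∀ r s l → T (isStrict (block (suc r) s ++ l)) →
            topRun (block (suc r) s ++ l) % k ≡ suc r % k →
            CanStack s l × AddBlock (suc r) (seqLengths l) (seqLengths (block (suc r) s ++ l))
  unstack r s l st rewrite seqLengths-block r s l = go l (proj₁ (isStrict-block++⁻ r s l st))
    where
    go : ∀ l → head₀ l < s → head₀ (runsFrom s (suc r) l) % k ≡ suc r % k →
         CanStack s l × AddBlock (suc r) (seqLengths l) (runsFrom s (suc r) l)
    go []       0<s _ = on-empty 0<s , new-run []
    go (y ∷ ys) y<s top with suc y ≟ s
    ... | yes y+1≡s rewrite runsFrom-merge s (suc r) y ys y+1≡s =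
      let top≡0 = extend-top⁻ (suc r) (seqLengths (y ∷ ys)) (seqLengths≢[] y ys) top
      in on-run y+1≡s top≡0 , extend-top (suc r) (seqLengths (y ∷ ys)) (seqLengths≢[] y ys) top≡0
    ... | no y+1≢s rewrite runsFrom-gap s (suc r) y ys y+1≢s = on-gap (≤∧≢⇒< y<s y+1≢s) , new-run _

  addBlock-top : ∀ {r Ls Rs} → AddBlock r Ls Rs → head₀ Rs % k ≡ r % k
  addBlock-top         (new-run _)            = refl
  addBlock-top {r = r} (extend-run L _ L%k≡0) = %-remove-+ʳ r (m%n≡0⇒n∣m L k L%k≡0)

  addBlock-admissible : ∀ {r Ls Rs} → T (admissible r) → AddBlock r Ls Rs →
                        T (allB admissible Ls) → T (allB admissible Rs)
  addBlock-admissible adm (new-run _)           h = from T-∧ (adm , h)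
  addBlock-admissible {r} adm ab@(extend-run L _ _) h =
    from T-∧ ( subst T (admissible-cong r (r + L) (sym (addBlock-top ab))) adm
             , proj₂ (to (T-∧ {admissible L}) h))

  addBlock-admissible⁻ : ∀ {r Ls Rs} → AddBlock r Ls Rs → T (allB admissible Rs) → T (allB admissible Ls)
  addBlock-admissible⁻ {r} (new-run _)            h = proj₂ (to (T-∧ {admissible r}) h)
  addBlock-admissible⁻ {r} (extend-run L _ L%k≡0) h =
    from T-∧ (from T-∨ (inj₁ (≡⇒≡ᵇ (L % k) 0 L%k≡0)) , proj₂ (to (T-∧ {admissible (r + L)}) h))

  addBlock-count : ∀ {r Ls Rs} → AddBlock r Ls Rs → count Rs ≡ count [ r ] + count Ls
  addBlock-count {r} (new-run Ls)            = count-∷ r Ls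
  addBlock-count {r} ab@(extend-run L Ls L%k≡0) = begin
    count (r + L ∷ Ls)         ≡⟨ count-∷-cong (r + L) r Ls (addBlock-top ab) ⟩
    count (r ∷ Ls)             ≡⟨ count-∷ r Ls ⟩
    count [ r ] + count Ls     ≡⟨ cong (count [ r ] +_) (count-∷-0 L Ls L%k≡0) ⟨
    count [ r ] + count (L ∷ Ls) ∎
    where open ≡-Reasoning

  canStack-on-k : ∀ {S l s} → CanStack S l → k + S ≤ s → CanStack s (block k S ++ l)
  canStack-on-k {S} {l} c k+S≤s with m≤n⇒m<n∨m≡n k+S≤s
  ... | inj₁ k+S<s = on-gap k+S<s
  ... | inj₂ k+S≡s = on-run k+S≡s (trans (addBlock-top (addBlock k-1 S l c)) (n%n≡0 k))

  canStack-on-k⁻ : ∀ {S l s} → CanStack s (block k S ++ l) → k + S ≤ s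
  canStack-on-k⁻ (on-run k+S≡s _) = ≤-reflexive k+S≡s
  canStack-on-k⁻ (on-gap k+S<s)   = ≤-trans (n≤1+n _) k+S<s

  canStack-on-a⁻ : ∀ {S l s} → CanStack S l → CanStack s (block a S ++ l) → suc (a + S) ≤ s
  canStack-on-a⁻ {S} {l} c (on-run _ top≡0) =
    contradiction (trans (sym (addBlock-top (addBlock a-1 S l c))) top≡0) a%k≢0
  canStack-on-a⁻         c (on-gap a+S<s)   = a+S<s

  InDSet : ℕ → ℕ → List ℕ → Set
  InDSet i j l = T (inD k a l) × count (seqLengths l) ≡ i × length l ≡ a * i + k * j

  InDSet-irrelevant : ∀ {i j l} → Irrelevant (InDSet i j l)
  InDSet-irrelevant (d , c , n) (d′ , c′ , n′) =
    cong₂ _,_ (T-irrelevant d d′) (cong₂ _,_ (≡-irrelevant c c′) (≡-irrelevant n n′))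

  inD-stack : ∀ r s l → T (admissible (suc r)) → CanStack s l → T (inD k a l) →
              T (inD k a (block (suc r) s ++ l))
  inD-stack r s l adm c d =
    let st , ad = to (T-∧ {isStrict l}) d
    in from T-∧ ( isStrict-block++ (suc r) s l (canStack⇒head< c) st
                , addBlock-admissible adm (addBlock r s l c) ad)

  length-stack-a : ∀ i j → a + (a * i + k * j) ≡ a * suc i + k * j
  length-stack-a i j = trans (sym (+-assoc a (a * i) (k * j))) (cong (_+ k * j) (sym (*-suc a i)))

  length-stack-k : ∀ i j → k + (a * i + k * j) ≡ a * i + k * suc j
  length-stack-k i j = begin
    k + (a * i + k * j)   ≡⟨ +-assoc k (a * i) (k * j) ⟨
    k + a * i + k * j     ≡⟨ cong (_+ k * j) (+-comm k (a * i)) ⟩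
    a * i + k + k * j     ≡⟨ +-assoc (a * i) k (k * j) ⟩
    a * i + (k + k * j)   ≡⟨ cong (a * i +_) (*-suc k j) ⟨
    a * i + k * suc j     ∎
    where open ≡-Reasoning

  InDSet-stack-a : ∀ {i j s l} → InDSet i j l → CanStack s l → InDSet (suc i) j (block a s ++ l)
  InDSet-stack-a {i} {j} {s} {l} (d , cnt , len) c =
    inD-stack a-1 s l (from T-∨ (inj₂ (≡⇒≡ᵇ (a % k) (a % k) refl))) c d ,
    trans (addBlock-count (addBlock a-1 s l c)) (cong₂ _+_ count-a cnt) ,
    trans (length-block-++ a s l) (trans (cong (a +_) len) (length-stack-a i j))

  InDSet-stack-k : ∀ {i j s l} → InDSet i j l → CanStack s l → InDSet i (suc j) (block k s ++ l)
  InDSet-stack-k {i} {j} {s} {l} (d , cnt , len) c =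
    inD-stack k-1 s l (from T-∨ (inj₁ (≡⇒≡ᵇ (k % k) 0 (n%n≡0 k)))) c d ,
    trans (addBlock-count (addBlock k-1 s l c)) (cong₂ _+_ count-k cnt) ,
    trans (length-block-++ k s l) (trans (cong (k +_) len) (length-stack-k i j))

  data TopBlock : ℕ → ℕ → List ℕ → Set where
    a-block : ∀ {i j} s l → CanStack s l → InDSet i j l → TopBlock (suc i) j (block a s ++ l)
    k-block : ∀ {i j} s l → CanStack s l → InDSet i j l → TopBlock i (suc j) (block k s ++ l)

  unstack-inD : ∀ r s l → T (inD k a (block (suc r) s ++ l)) →
                topRun (block (suc r) s ++ l) % k ≡ suc r % k →
                CanStack s l × T (inD k a l) ×
                count (seqLengths (block (suc r) s ++ l)) ≡ count [ suc r ] + count (seqLengths l)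
  unstack-inD r s l d top =
    let st , adm = to (T-∧ {isStrict (block (suc r) s ++ l)}) d
        c , ab = unstack r s l st top
    in c , from T-∧ (proj₂ (isStrict-block++⁻ r s l st) , addBlock-admissible⁻ ab adm) , addBlock-count ab

  length-unstack-a : ∀ {i j n} → a + n ≡ a * suc i + k * j → n ≡ a * i + k * j
  length-unstack-a {i} {j} eq = +-cancelˡ-≡ a _ _ (trans eq (sym (length-stack-a i j)))

  InDSet-unstack-a : ∀ {i j s l} → InDSet i j (block a s ++ l) → topRun (block a s ++ l) % k ≡ a % k →
                     TopBlock i j (block a s ++ l)
  InDSet-unstack-a {i} {j} {s} {l} (d , cnt , len) top =
    let c , d′ , cnt′ = unstack-inD a-1 s l d top
        i≡ = trans (cong (_+ count (seqLengths l)) (sym count-a)) (trans (sym cnt′) cnt)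
        len′ = length-unstack-a {count (seqLengths l)}
                 (trans (sym (length-block-++ a s l)) (trans len (cong (λ c → a * c + k * j) (sym i≡))))
    in subst (λ i → TopBlock i j (block a s ++ l)) i≡ (a-block s l c (d′ , refl , len′))

  length-unstack-k : ∀ {i j n} → a * i ≤ n → k + n ≡ a * i + k * j →
                     ∃ λ j′ → j ≡ suc j′ × n ≡ a * i + k * j′
  length-unstack-k {i} {zero}   {n} a*i≤n eq =
    contradiction (≤-reflexive (trans eq (trans (cong (a * i +_) (*-zeroʳ k)) (+-identityʳ (a * i)))))
                  (<⇒≱ (s≤s (≤-trans a*i≤n (m≤n+m n k-1))))
  length-unstack-k {i} {suc j′} a*i≤n eq =
    j′ , refl , +-cancelˡ-≡ k _ _ (trans eq (sym (length-stack-k i j′)))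

  InDSet-unstack-k : ∀ {i j s l} → InDSet i j (block k s ++ l) → topRun (block k s ++ l) % k ≡ 0 →
                     TopBlock i j (block k s ++ l)
  InDSet-unstack-k {i} {j} {s} {l} (d , cnt , len) top =
    let c , d′ , cnt′ = unstack-inD k-1 s l d (trans top (sym (n%n≡0 k)))
        i≡ = trans (cong (_+ count (seqLengths l)) (sym count-k)) (trans (sym cnt′) cnt)
        a*i≤length = subst₂ (λ c n → a * c ≤ n) i≡ (sum-seqLengths l) (a*count≤sum (seqLengths l))
        j′ , j≡ , len′ = length-unstack-k a*i≤length (trans (sym (length-block-++ k s l)) len)
    in subst (λ j → TopBlock i j (block k s ++ l)) (sym j≡) (k-block s l c (d′ , i≡ , len′))

  topRun-class : ∀ x xs → T (inD k a (x ∷ xs)) → topRun (x ∷ xs) % k ≡ 0 ⊎ topRun (x ∷ xs) % k ≡ a % k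
  topRun-class x xs d =
    admissible⁻ (topRun (x ∷ xs))
      (allB-head admissible (seqLengths (x ∷ xs)) (seqLengths≢[] x xs)
                 (proj₂ (to (T-∧ {isStrict (x ∷ xs)}) d)))

  k≤topRun : ∀ x xs → topRun (x ∷ xs) % k ≡ 0 → k ≤ topRun (x ∷ xs)
  k≤topRun x xs top≡0 = ∣⇒≤ {{>-nonZero (n≤head-runsFrom x 1 xs)}} (m%n≡0⇒n∣m (topRun (x ∷ xs)) k top≡0)

  peel-top : ∀ {i j} x xs → InDSet i j (x ∷ xs) → TopBlock i j (x ∷ xs)
  peel-top x xs mem@(d , _ , _) with topRun-class x xs d
  ... | inj₁ top≡0 with split-block k-1 (x ∷ xs) (k≤topRun x xs top≡0)
  ...   | block-on s l = InDSet-unstack-k mem top≡0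
  peel-top x xs mem | inj₂ top≡a with split-block a-1 (x ∷ xs) (m%k≡a%k⇒a≤m (topRun (x ∷ xs)) top≡a)
  ...   | block-on s l = InDSet-unstack-a mem top≡a

module Assembly (k-1 a-1 : ℕ) (a<k : suc a-1 < suc k-1) where

  open Stacking k-1 a-1 a<k

  start : ℕ → ℕ → ℕ → ℕ
  start i j y = suc (y + (a * i + k * j))

  start-sucˡ : ∀ i j y → start (suc i) j y ≡ a + start i j y
  start-sucˡ i j y = arith a k i j y
    where
    arith : ∀ a k i j y → suc (y + (a * suc i + k * j)) ≡ a + suc (y + (a * i + k * j))
    arith = solve-∀

  start-sucʳ : ∀ i j y → start i (suc j) y ≡ k + start i j y
  start-sucʳ i j y = arith a k i j y
    where
    arith : ∀ a k i j y → suc (y + (a * i + k * suc j)) ≡ k + suc (y + (a * i + k * j))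
    arith = solve-∀

  start-+ : ∀ i j y d → start i j (y + d) ≡ start i j y + d
  start-+ i j y d = arith (a * i + k * j) y d
    where
    arith : ∀ n y d → suc (y + d + n) ≡ suc (y + n) + d
    arith = solve-∀

  start-0-0 : start 0 0 0 ≡ 1
  start-0-0 = cong suc (cong₂ _+_ (*-zeroʳ a) (*-zeroʳ k))

  start-mono : ∀ i j {y y′} → y ≤ y′ → start i j y ≤ start i j y′
  start-mono i j y≤y′ = s≤s (+-monoˡ-≤ (a * i + k * j) y≤y′)

  start-injective : ∀ i j {y y′} → start i j y ≡ start i j y′ → y ≡ y′
  start-injective i j eq = +-cancelʳ-≡ (a * i + k * j) _ _ (suc-injective eq)

  start-≤⇒ : ∀ i j {f s} → start i j f ≤ s → ∃ λ d → f ≤ d × s ≡ start i j d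
  start-≤⇒ i j {f} le with e , refl ← m≤n⇒∃[o]m+o≡n le = f + e , m≤m+n f e , sym (start-+ i j f e)

  aMinShift : ∀ {i} → Vec ℕ i → ℕ
  aMinShift         []      = 0
  aMinShift {suc i} (x ∷ _) = suc (i + x)

  minShift : ∀ {i j} → Vec ℕ i → Vec ℕ j → ℕ
  minShift u v = aMinShift u ⊔ vhead₀ v

  -- The top block is the one of larger shift, i + x for the a-block and y for the k-block, the
  -- a-block on ties.
  assemble : ∀ {i j} → Vec ℕ i → Vec ℕ j → List ℕ
  assemble                []      []      = []
  assemble {suc i}        (x ∷ u) []      = block a (start i 0 (i + x)) ++ assemble u []
  assemble {_} {suc j}    []      (y ∷ v) = block k (start 0 j y) ++ assemble [] v
  assemble {suc i} {suc j} (x ∷ u) (y ∷ v) with y ≤ᵇ i + x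
  ... | true  = block a (start i (suc j) (i + x)) ++ assemble u (y ∷ v)
  ... | false = block k (start (suc i) j y) ++ assemble (x ∷ u) v

  assemble-a : ∀ {i j} x (u : Vec ℕ i) (v : Vec ℕ j) → vhead₀ v ≤ i + x →
               assemble (x ∷ u) v ≡ block a (start i j (i + x)) ++ assemble u v
  assemble-a         x u []      _     = refl
  assemble-a {i} x u (y ∷ v) y≤i+x with y ≤ᵇ i + x in eq
  ... | true  = refl
  ... | false = contradiction (subst T eq (≤⇒≤ᵇ y≤i+x)) λ ()

  assemble-k : ∀ {i j} y (u : Vec ℕ i) (v : Vec ℕ j) → aMinShift u ≤ y →
               assemble u (y ∷ v) ≡ block k (start i j y) ++ assemble u v
  assemble-k         y []      v _     = refl
  assemble-k {suc i} y (x ∷ u) v i+x<y with y ≤ᵇ i + x in eq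
  ... | true  = contradiction (≤ᵇ⇒≤ y (i + x) (subst T (sym eq) tt)) (<⇒≱ i+x<y)
  ... | false = refl

  data Top : ∀ {i j} → Vec ℕ i → Vec ℕ j → Set where
    top-none : Top [] []
    top-a : ∀ {i j} x (u : Vec ℕ i) (v : Vec ℕ j) → vhead₀ v ≤ i + x → Top (x ∷ u) v
    top-k : ∀ {i j} y (u : Vec ℕ i) (v : Vec ℕ j) → aMinShift u ≤ y → Top u (y ∷ v)

  top : ∀ {i j} (u : Vec ℕ i) (v : Vec ℕ j) → Top u v
  top []      []      = top-none
  top (x ∷ u) []      = top-a x u [] z≤n
  top []      (y ∷ v) = top-k y [] v z≤n
  top {suc i} (x ∷ u) (y ∷ v) with y ≤? i + x
  ... | yes y≤i+x = top-a x u (y ∷ v) y≤i+x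
  ... | no  y≰i+x = top-k y (x ∷ u) v (≰⇒> y≰i+x)

  aMinShift≤ : ∀ {i} (u : Vec ℕ i) x → vhead₀ u ≤ x → aMinShift u ≤ i + x
  aMinShift≤         []       x _    = z≤n
  aMinShift≤ {suc i} (x₀ ∷ _) x x₀≤x = s≤s (+-monoʳ-≤ i x₀≤x)

  aMinShift≤⁻ : ∀ {i} (u : Vec ℕ i) x → aMinShift u ≤ i + x → vhead₀ u ≤ x
  aMinShift≤⁻         []       x _  = z≤n
  aMinShift≤⁻ {suc i} (x₀ ∷ _) x le = +-cancelˡ-≤ i x₀ x (s≤s⁻¹ le)

  i≤aMinShift : ∀ {i} (u : Vec ℕ i) → i ≤ aMinShift u
  i≤aMinShift         []      = z≤n
  i≤aMinShift {suc i} (x ∷ _) = s≤s (m≤m+n i x)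

  start-minShift-a : ∀ {i j} x (u : Vec ℕ i) (v : Vec ℕ j) → vhead₀ v ≤ i + x →
                  start (suc i) j (minShift (x ∷ u) v) ≡ suc (a + start i j (i + x))
  start-minShift-a {i} {j} x u v v≤i+x = begin
    start (suc i) j (suc (i + x) ⊔ vhead₀ v)  ≡⟨ cong (start (suc i) j) (m≥n⇒m⊔n≡m (m≤n⇒m≤1+n v≤i+x)) ⟩
    start (suc i) j (suc (i + x))             ≡⟨ start-sucˡ i j (suc (i + x)) ⟩
    a + suc (start i j (i + x))               ≡⟨ +-suc a _ ⟩
    suc (a + start i j (i + x))               ∎
    where open ≡-Reasoning

  start-minShift-k : ∀ {i j} y (u : Vec ℕ i) (v : Vec ℕ j) → aMinShift u ≤ y →
                  start i (suc j) (minShift u (y ∷ v)) ≡ k + start i j y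
  start-minShift-k {i} {j} y u v u≤y =
    trans (cong (start i (suc j)) (m≤n⇒m⊔n≡n u≤y)) (start-sucʳ i j y)

  canStack-assemble : ∀ {i j s} (u : Vec ℕ i) (v : Vec ℕ j) → Decreasing u → Decreasing v →
                      start i j (minShift u v) ≤ s → CanStack s (assemble u v)

  canStack-a : ∀ {i j} x (u : Vec ℕ i) (v : Vec ℕ j) → Decreasing (x ∷ u) → Decreasing v →
               vhead₀ v ≤ i + x → CanStack (start i j (i + x)) (assemble u v)
  canStack-a {i} {j} x u v (u≤x , du) dv v≤i+x =
    canStack-assemble u v du dv (start-mono i j (⊔-lub (aMinShift≤ u x u≤x) v≤i+x))

  canStack-k : ∀ {i j} y (u : Vec ℕ i) (v : Vec ℕ j) → Decreasing u → Decreasing (y ∷ v) →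
               aMinShift u ≤ y → CanStack (start i j y) (assemble u v)
  canStack-k {i} {j} y u v du (v≤y , dv) u≤y =
    canStack-assemble u v du dv (start-mono i j (⊔-lub u≤y v≤y))

  canStack-assemble {s = s} u v du dv le with top u v
  ... | top-none = on-empty (≤-trans (s≤s z≤n) le)
  ... | top-a x u′ v v≤i+x =
    subst (CanStack s) (sym (assemble-a x u′ v v≤i+x))
      (on-gap (subst (_≤ s) (start-minShift-a x u′ v v≤i+x) le))
  ... | top-k y u v′ u≤y =
    subst (CanStack s) (sym (assemble-k y u v′ u≤y))
      (canStack-on-k (canStack-k y u v′ du dv u≤y) (subst (_≤ s) (start-minShift-k y u v′ u≤y) le))

  canStack-assemble⁻ : ∀ {i j s} (u : Vec ℕ i) (v : Vec ℕ j) → Decreasing u → Decreasing v →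
                       CanStack s (assemble u v) → start i j (minShift u v) ≤ s
  canStack-assemble⁻ {s = s} u v du dv c with top u v
  ... | top-none with on-empty 0<s ← c =
    subst (_≤ s) (sym start-0-0) 0<s
  ... | top-a x u′ v v≤i+x =
    subst (_≤ s) (sym (start-minShift-a x u′ v v≤i+x))
      (canStack-on-a⁻ (canStack-a x u′ v du dv v≤i+x) (subst (CanStack s) (assemble-a x u′ v v≤i+x) c))
  ... | top-k y u v′ u≤y =
    subst (_≤ s) (sym (start-minShift-k y u v′ u≤y))
      (canStack-on-k⁻ (subst (CanStack s) (assemble-k y u v′ u≤y) c))

  topRun-a : ∀ {i j} x (u : Vec ℕ i) (v : Vec ℕ j) → Decreasing (x ∷ u) → Decreasing v →
             vhead₀ v ≤ i + x → topRun (assemble (x ∷ u) v) % k ≡ a % k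
  topRun-a x u v du dv v≤i+x rewrite assemble-a x u v v≤i+x =
    addBlock-top (addBlock a-1 _ _ (canStack-a x u v du dv v≤i+x))

  topRun-k : ∀ {i j} y (u : Vec ℕ i) (v : Vec ℕ j) → Decreasing u → Decreasing (y ∷ v) →
             aMinShift u ≤ y → topRun (assemble u (y ∷ v)) % k ≡ 0
  topRun-k y u v du dv u≤y rewrite assemble-k y u v u≤y =
    trans (addBlock-top (addBlock k-1 _ _ (canStack-k y u v du dv u≤y))) (n%n≡0 k)

  assemble-InDSet : ∀ {i j} (u : Vec ℕ i) (v : Vec ℕ j) → Decreasing u → Decreasing v →
                    InDSet i j (assemble u v)
  assemble-InDSet u v du dv with top u v
  ... | top-none = tt , refl , sym (cong₂ _+_ (*-zeroʳ a) (*-zeroʳ k))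
  ... | top-a x u′ v v≤i+x rewrite assemble-a x u′ v v≤i+x =
    InDSet-stack-a (assemble-InDSet u′ v (proj₂ du) dv) (canStack-a x u′ v du dv v≤i+x)
  ... | top-k y u v′ u≤y rewrite assemble-k y u v′ u≤y =
    InDSet-stack-k (assemble-InDSet u v′ du (proj₂ dv)) (canStack-k y u v′ du dv u≤y)

  assemble-injective : ∀ {i j} {u u′ : Vec ℕ i} {v v′ : Vec ℕ j} →
                       Decreasing u → Decreasing v → Decreasing u′ → Decreasing v′ →
                       assemble u v ≡ assemble u′ v′ → u ≡ u′ × v ≡ v′
  assemble-injective {u = u} {u′} {v} {v′} du dv du′ dv′ eq with top u v | top u′ v′
  ... | top-none | top-none = refl , refl
  ... | top-a {i} {j} x u₁ v v≤i+x | top-a x′ u₁′ v′ v′≤i+x′ =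
    let S≡S′ , rest≡ = block-++-injective a-1
                         (trans (sym (assemble-a x u₁ v v≤i+x)) (trans eq (assemble-a x′ u₁′ v′ v′≤i+x′)))
        u₁≡ , v≡ = assemble-injective (proj₂ du) dv (proj₂ du′) dv′ rest≡
    in cong₂ _∷_ (+-cancelˡ-≡ i x x′ (start-injective i j S≡S′)) u₁≡ , v≡
  ... | top-k {i} {j} y u v₁ u≤y | top-k y′ u′ v₁′ u′≤y′ =
    let S≡S′ , rest≡ = block-++-injective k-1
                         (trans (sym (assemble-k y u v₁ u≤y)) (trans eq (assemble-k y′ u′ v₁′ u′≤y′)))
        u≡ , v₁≡ = assemble-injective du (proj₂ dv) du′ (proj₂ dv′) rest≡
    in u≡ , cong₂ _∷_ (start-injective i j S≡S′) v₁≡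
  ... | top-a x u₁ v v≤i+x | top-k y′ u′ v₁′ u′≤y′ =
    contradiction (trans (sym (topRun-a x u₁ v du dv v≤i+x))
                         (trans (cong (λ l → topRun l % k) eq) (topRun-k y′ u′ v₁′ du′ dv′ u′≤y′))) a%k≢0
  ... | top-k y u v₁ u≤y | top-a x′ u₁′ v′ v′≤i+x′ =
    contradiction (trans (sym (topRun-a x′ u₁′ v′ du′ dv′ v′≤i+x′))
                         (trans (cong (λ l → topRun l % k) (sym eq)) (topRun-k y u v₁ du dv u≤y))) a%k≢0

  extend-a : ∀ {i j s} (u : Vec ℕ i) (v : Vec ℕ j) → Decreasing u → Decreasing v →
             CanStack s (assemble u v) →
             ∃ λ x → Decreasing (x ∷ u) × assemble (x ∷ u) v ≡ block a s ++ assemble u v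
  extend-a {i} {j} u v du dv c =
    x , (aMinShift≤⁻ u x (≤-trans (m≤m⊔n _ _) minShift≤i+x) , du) ,
    trans (assemble-a x u v (≤-trans (m≤n⊔m _ _) minShift≤i+x))
          (cong (λ S → block a S ++ assemble u v) (trans (cong (start i j) i+x≡d) (sym s≡)))
    where
    lower = start-≤⇒ i j (canStack-assemble⁻ u v du dv c)
    d = proj₁ lower
    minShift≤d = proj₁ (proj₂ lower)
    s≡ = proj₂ (proj₂ lower)
    x = d ∸ i
    i+x≡d : i + x ≡ d
    i+x≡d = m+[n∸m]≡n (≤-trans (i≤aMinShift u) (≤-trans (m≤m⊔n _ _) minShift≤d))
    minShift≤i+x : minShift u v ≤ i + x
    minShift≤i+x = subst (minShift u v ≤_) (sym i+x≡d) minShift≤d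

  extend-k : ∀ {i j s} (u : Vec ℕ i) (v : Vec ℕ j) → Decreasing u → Decreasing v →
             CanStack s (assemble u v) →
             ∃ λ y → Decreasing (y ∷ v) × assemble u (y ∷ v) ≡ block k s ++ assemble u v
  extend-k {i} {j} u v du dv c =
    let y , minShift≤y , s≡ = start-≤⇒ i j (canStack-assemble⁻ u v du dv c)
    in y , (≤-trans (m≤n⊔m _ _) minShift≤y , dv) ,
       trans (assemble-k y u v (≤-trans (m≤m⊔n _ _) minShift≤y))
             (cong (λ S → block k S ++ assemble u v) (sym s≡))

  assemble-surjective : ∀ {i j} l → InDSet i j l →
                        ∃₂ λ (u : Vec ℕ i) (v : Vec ℕ j) → Decreasing u × Decreasing v × assemble u v ≡ l
  assemble-surjective {zero}  {zero}  []       _             = [] , [] , tt , tt , refl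
  assemble-surjective {suc i}         []       (_ , _ , ())
  assemble-surjective {zero}  {suc j} []       (_ , _ , len) =
    contradiction (trans len (cong (_+ k * suc j) (*-zeroʳ a))) λ ()
  assemble-surjective (x ∷ xs) mem with peel-top x xs mem
  ... | a-block s l c mem′ with assemble-surjective l mem′
  ...   | u , v , du , dv , refl with extend-a u v du dv c
  ...     | x₀ , dxu , eq = x₀ ∷ u , v , dxu , dv , eq
  assemble-surjective (x ∷ xs) mem | k-block s l c mem′ with assemble-surjective l mem′
  ...   | u , v , du , dv , refl with extend-k u v du dv c
  ...     | y₀ , dyv , eq = u , y₀ ∷ v , du , dyv , eq

  baseSum : ℕ → ℕ → ℕ
  baseSum i j = tri (start i j 0) + a * tri i

  baseSum-a : ∀ i j x → sum (block a (start i j (i + x))) + baseSum i j ≡ baseSum (suc i) j + a * x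
  baseSum-a i j x = begin
    sum (block a (start i j (i + x))) + baseSum i j
      ≡⟨ cong (_+ baseSum i j) (sum-block a (start i j (i + x))) ⟩
    a * start i j (i + x) + tri a + (tri S₀ + a * tri i)
      ≡⟨ cong (λ S → a * S + tri a + (tri S₀ + a * tri i)) (start-+ i j 0 (i + x)) ⟩
    a * (S₀ + (i + x)) + tri a + (tri S₀ + a * tri i)
      ≡⟨ arith a S₀ i x (tri a) (tri S₀) (tri i) ⟩
    a * S₀ + tri a + tri S₀ + a * (i + tri i) + a * x
      ≡⟨ cong (λ t → t + a * tri (suc i) + a * x) (tri-+ a S₀) ⟨
    tri (a + S₀) + a * tri (suc i) + a * x
      ≡⟨ cong (λ S → tri S + a * tri (suc i) + a * x) (start-sucˡ i j 0) ⟨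
    baseSum (suc i) j + a * x
      ∎
    where
    open ≡-Reasoning
    S₀ = start i j 0
    arith : ∀ a S i x ta tS ti →
            a * (S + (i + x)) + ta + (tS + a * ti) ≡ a * S + ta + tS + a * (i + ti) + a * x
    arith = solve-∀

  baseSum-k : ∀ i j y → sum (block k (start i j y)) + baseSum i j ≡ baseSum i (suc j) + k * y
  baseSum-k i j y = begin
    sum (block k (start i j y)) + baseSum i j
      ≡⟨ cong (_+ baseSum i j) (sum-block k (start i j y)) ⟩
    k * start i j y + tri k + (tri S₀ + a * tri i)
      ≡⟨ cong (λ S → k * S + tri k + (tri S₀ + a * tri i)) (start-+ i j 0 y) ⟩
    k * (S₀ + y) + tri k + (tri S₀ + a * tri i)
      ≡⟨ arith k S₀ y (tri k) (tri S₀) (a * tri i) ⟩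
    k * S₀ + tri k + tri S₀ + a * tri i + k * y
      ≡⟨ cong (λ t → t + a * tri i + k * y) (tri-+ k S₀) ⟨
    tri (k + S₀) + a * tri i + k * y
      ≡⟨ cong (λ S → tri S + a * tri i + k * y) (start-sucʳ i j 0) ⟨
    baseSum i (suc j) + k * y
      ∎
    where
    open ≡-Reasoning
    S₀ = start i j 0
    arith : ∀ k S y tk tS t → k * (S + y) + tk + (tS + t) ≡ k * S + tk + tS + t + k * y
    arith = solve-∀

  sum-assemble : ∀ {i j} (u : Vec ℕ i) (v : Vec ℕ j) →
                 sum (assemble u v) ≡ baseSum i j + a * Vec.sum u + k * Vec.sum v
  sum-assemble u v with top u v
  ... | top-none = sym (begin
    baseSum 0 0 + a * 0 + k * 0  ≡⟨ cong₂ (λ p q → baseSum 0 0 + p + q) (*-zeroʳ a) (*-zeroʳ k) ⟩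
    baseSum 0 0 + 0 + 0          ≡⟨ trans (+-identityʳ _) (+-identityʳ _) ⟩
    baseSum 0 0                  ≡⟨ cong₂ _+_ (cong tri start-0-0) (*-zeroʳ a) ⟩
    0                            ∎)
    where open ≡-Reasoning
  ... | top-a {i} {j} x u′ v v≤i+x = begin
    sum (assemble (x ∷ u′) v)
      ≡⟨ cong sum (assemble-a x u′ v v≤i+x) ⟩
    sum (block a S ++ assemble u′ v)
      ≡⟨ sum-++ (block a S) (assemble u′ v) ⟩
    sum (block a S) + sum (assemble u′ v)
      ≡⟨ cong (sum (block a S) +_) (sum-assemble u′ v) ⟩
    sum (block a S) + (baseSum i j + a * Vec.sum u′ + k * Vec.sum v)
      ≡⟨ arith₁ (sum (block a S)) (baseSum i j) (a * Vec.sum u′) (k * Vec.sum v) ⟩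
    sum (block a S) + baseSum i j + a * Vec.sum u′ + k * Vec.sum v
      ≡⟨ cong (λ t → t + a * Vec.sum u′ + k * Vec.sum v) (baseSum-a i j x) ⟩
    baseSum (suc i) j + a * x + a * Vec.sum u′ + k * Vec.sum v
      ≡⟨ arith₂ (baseSum (suc i) j) a x (Vec.sum u′) (k * Vec.sum v) ⟩
    baseSum (suc i) j + a * (x + Vec.sum u′) + k * Vec.sum v
      ∎
    where
    open ≡-Reasoning
    S = start i j (i + x)
    arith₁ : ∀ p b u v → p + (b + u + v) ≡ p + b + u + v
    arith₁ = solve-∀
    arith₂ : ∀ b a x u v → b + a * x + a * u + v ≡ b + a * (x + u) + v
    arith₂ = solve-∀
  ... | top-k {i} {j} y u v′ u≤y = begin
    sum (assemble u (y ∷ v′))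
      ≡⟨ cong sum (assemble-k y u v′ u≤y) ⟩
    sum (block k S ++ assemble u v′)
      ≡⟨ sum-++ (block k S) (assemble u v′) ⟩
    sum (block k S) + sum (assemble u v′)
      ≡⟨ cong (sum (block k S) +_) (sum-assemble u v′) ⟩
    sum (block k S) + (baseSum i j + a * Vec.sum u + k * Vec.sum v′)
      ≡⟨ arith₁ (sum (block k S)) (baseSum i j) (a * Vec.sum u) (k * Vec.sum v′) ⟩
    sum (block k S) + baseSum i j + a * Vec.sum u + k * Vec.sum v′
      ≡⟨ cong (λ t → t + a * Vec.sum u + k * Vec.sum v′) (baseSum-k i j y) ⟩
    baseSum i (suc j) + k * y + a * Vec.sum u + k * Vec.sum v′
      ≡⟨ arith₂ (baseSum i (suc j)) k y (a * Vec.sum u) (Vec.sum v′) ⟩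
    baseSum i (suc j) + a * Vec.sum u + k * (y + Vec.sum v′)
      ∎
    where
    open ≡-Reasoning
    S = start i j y
    arith₁ : ∀ p b u v → p + (b + u + v) ≡ p + b + u + v
    arith₁ = solve-∀
    arith₂ : ∀ b k y u v → b + k * y + u + k * v ≡ b + u + k * (y + v)
    arith₂ = solve-∀

  assemble-zeros-k : ∀ j → assemble [] (zeros j) ≡ block (j * k) 1
  assemble-zeros-k zero    = refl
  assemble-zeros-k (suc j) = begin
    block k (start 0 j 0) ++ assemble [] (zeros j)
      ≡⟨ cong₂ (λ S l → block k S ++ l) (arith a k j) (assemble-zeros-k j) ⟩
    block k (j * k + 1) ++ block (j * k) 1          ≡⟨ block-+ k (j * k) 1 ⟨
    block (k + j * k) 1                             ∎
    where
    open ≡-Reasoning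
    arith : ∀ a k j → suc (a * 0 + k * j) ≡ j * k + 1
    arith = solve-∀

  beta≡assemble : ∀ i j → beta k a i j ≡ assemble (zeros i) (zeros j)
  beta≡assemble zero    j =
    trans (cong reverse (++-identityʳ (map suc (upTo (j * k)))))
          (trans (reverse-map-upTo 1 (j * k)) (sym (assemble-zeros-k j)))
  beta≡assemble (suc i) j = begin
    reverse (X ++ concatMap f (upTo (suc i)))      ≡⟨ cong (λ l → reverse (X ++ l)) (concatMap-upTo-suc f i) ⟩
    reverse (X ++ (concatMap f (upTo i) ++ f i))   ≡⟨ cong reverse (++-assoc X (concatMap f (upTo i)) (f i)) ⟨
    reverse ((X ++ concatMap f (upTo i)) ++ f i)   ≡⟨ reverse-++ (X ++ concatMap f (upTo i)) (f i) ⟩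
    reverse (f i) ++ beta k a i j                  ≡⟨ cong₂ _++_ top-block (beta≡assemble i j) ⟩
    block a (start i j (i + 0)) ++ assemble (zeros i) (zeros j)
      ≡⟨ assemble-a 0 (zeros i) (zeros j) (≤-trans (≤-reflexive (vhead-zeros j)) z≤n) ⟨
    assemble (zeros (suc i)) (zeros j)             ∎
    where
    open ≡-Reasoning
    X = map suc (upTo (j * k))
    f : ℕ → List ℕ
    f m = map (λ t → j * k + m * a + suc m + t) (upTo a)
    arith : ∀ a k i j → j * k + i * a + suc i ≡ suc (i + 0 + (a * i + k * j))
    arith = solve-∀
    top-block : reverse (f i) ≡ block a (start i j (i + 0))
    top-block = trans (reverse-map-upTo (j * k + i * a + suc i) a) (cong (block a) (arith a k i j))

  sum-beta : ∀ i j → sum (beta k a i j) ≡ baseSum i j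
  sum-beta i j = begin
    sum (beta k a i j)
      ≡⟨ cong sum (beta≡assemble i j) ⟩
    sum (assemble (zeros i) (zeros j))
      ≡⟨ sum-assemble (zeros i) (zeros j) ⟩
    baseSum i j + a * Vec.sum (zeros i) + k * Vec.sum (zeros j)
      ≡⟨ cong₂ (λ p q → baseSum i j + a * p + k * q) (sum-zeros i) (sum-zeros j) ⟩
    baseSum i j + a * 0 + k * 0
      ≡⟨ cong₂ (λ p q → baseSum i j + p + q) (*-zeroʳ a) (*-zeroʳ k) ⟩
    baseSum i j + 0 + 0
      ≡⟨ trans (+-identityʳ _) (+-identityʳ _) ⟩
    baseSum i j
      ∎
    where open ≡-Reasoning

  InDSet-beta : ∀ i j → InDSet i j (beta k a i j)
  InDSet-beta i j = subst (InDSet i j) (sym (beta≡assemble i j))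
                        (assemble-InDSet (zeros i) (zeros j) (zeros-decreasing i) (zeros-decreasing j))

module Correspondence (k-1 a-1 : ℕ) (a<k : suc a-1 < suc k-1) (i j : ℕ) where

  open Stacking k-1 a-1 a<k
  open Assembly k-1 a-1 a<k
  module A = Multiples a-1
  module K = Multiples k-1

  module μ↔ = Inverse (A.TSet↔DecVec i)
  module η↔ = Inverse (K.TSet↔DecVec j)

  encode↔ : (BetaSet k a i j × TSet a i × TSet k j) ↔ (DecVec i × DecVec j)
  encode↔ = mk↔ₛ′
    (λ (_ , μ , η) → μ↔.to μ , η↔.to η)
    (λ (u , v) → (beta k a i j , refl) , μ↔.from u , η↔.from v)
    (λ (u , v) → cong₂ _,_ (μ↔.strictlyInverseˡ u) (η↔.strictlyInverseˡ v))
    (λ { ((_ , refl) , μ , η) →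
         cong ((beta k a i j , refl) ,_) (cong₂ _,_ (μ↔.strictlyInverseʳ μ) (η↔.strictlyInverseʳ η)) })

  assembleDSet : DecVec i × DecVec j → DSet k a i j
  assembleDSet ((u , du) , (v , dv)) = assemble u v , assemble-InDSet u v du dv

  assembleDSet-bijective : Bijective _≡_ _≡_ assembleDSet
  assembleDSet-bijective = injective , strictlySurjective⇒surjective surjective
    where
    injective : ∀ {x y} → assembleDSet x ≡ assembleDSet y → x ≡ y
    injective {(u , du) , (v , dv)} {(u′ , du′) , (v′ , dv′)} eq =
      let u≡u′ , v≡v′ = assemble-injective du dv du′ dv′ (cong proj₁ eq)
      in cong₂ _,_ (Σ-≡-irrelevant Decreasing-irrelevant u≡u′) (Σ-≡-irrelevant Decreasing-irrelevant v≡v′)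
    surjective : ∀ y → ∃ λ x → assembleDSet x ≡ y
    surjective (l , mem) =
      let u , v , du , dv , eq = assemble-surjective l mem
      in ((u , du) , (v , dv)) , Σ-≡-irrelevant (λ {l} → InDSet-irrelevant {i} {j} {l}) eq

  φ : BetaSet k a i j × TSet a i × TSet k j → DSet k a i j
  φ = assembleDSet ∘ Inverse.to encode↔

  φ-bijective : Bijective _≡_ _≡_ φ
  φ-bijective = Compose.bijective _≡_ _≡_ _≡_ (Bijection.bijective (↔⇒⤖ encode↔)) assembleDSet-bijective

  φ-statistics : ∀ b μ η → let lam = proj₁ (φ (b , μ , η)) in
    (sum lam ≡ sum (proj₁ b) + sum (proj₁ μ) + sum (proj₁ η)) ×
    (length lam ≡ length (proj₁ b)) ×
    (sl k a lam ≡ sl k a (proj₁ b))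
  φ-statistics (_ , refl) (μ , tμ) (η , tη) =
    (begin
      sum (assemble u v)                          ≡⟨ sum-assemble u v ⟩
      baseSum i j + a * Vec.sum u + k * Vec.sum v ≡⟨ cong₂ _+_ (cong₂ _+_ (sym (sum-beta i j)) (sym (A.sum-quotients i μ tμ)))
                                                               (sym (K.sum-quotients j η tη)) ⟩
      sum (beta k a i j) + sum μ + sum η          ∎) ,
    trans (proj₂ (proj₂ mem)) (sym (proj₂ (proj₂ (InDSet-beta i j)))) ,
    trans (proj₁ (proj₂ mem)) (sym (proj₁ (proj₂ (InDSet-beta i j))))
    where
    open ≡-Reasoning
    u = A.quotients i μ
    v = K.quotients j η
    mem = assemble-InDSet u v (A.quotients-decreasing i μ tμ) (K.quotients-decreasing j η tη)

lemma5p2 : (k a i j : ℕ) → 1 ≤ a → a < k →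
    Σ (BetaSet k a i j × TSet a i × TSet k j → DSet k a i j) λ φ →
      Bijective _≡_ _≡_ φ ×
      (∀ b μ η → let lam = proj₁ (φ (b , μ , η)) in
        (sum lam ≡ sum (proj₁ b) + sum (proj₁ μ) + sum (proj₁ η)) ×
        (length lam ≡ length (proj₁ b)) ×
        (sl k a lam ≡ sl k a (proj₁ b)))
lemma5p2 zero      _         _ _ _  ()
lemma5p2 (suc k-1) zero      _ _ ()
lemma5p2 (suc k-1) (suc a-1) i j _  a<k = φ , φ-bijective , φ-statistics
  where open Correspondence k-1 a-1 a<k i j
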